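{- Let $F$ be a forest consisting of two vertex-disjoint stars $S_p$ and $S_r$ with $p,r\ge 1$. Then $\mathrm{ex}(n,F,\textup{rainbow- }F)=\Theta(n^2)$ as $n\to\infty$.
   Context: $S_p$ denotes the star with $p$ leaves, i.e. a vertex adjacent to $p$ other vertices and no other edges. An edge-coloring is proper if any two edges sharing a vertex receive different colors. A subgraph of an edge-colored graph is rainbow if all its edges have distinct colors. For graphs $H$ and $F$, $\mathrm{ex}(n,H,\textup{rainbow- }F)$ denotes the maximum number of copies of $H$ (subgraphs isomorphic to $H$) in a graph $G$ on $n$ vertices equipped with a proper edge-coloring in which there is no rainbow copy of $F$. -}

module Defs where

open import Data.Nat using (ℕ; zero; suc; _+_; _*_; _≤_)
open import Data.Bool using (Bool; true; false)
open import Data.Fin using (Fin; zero; suc; splitAt)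
open import Data.Fin.Subset using (Subset; _∈_)
open import Data.Vec using (Vec; lookup)
open import Data.Sum using (_⊎_; inj₁; inj₂)
open import Data.Product using (_×_; _,_; ∃; ∃-syntax; Σ-syntax)
open import Data.List using (List; length)
open import Data.List.Relation.Unary.All using (All)
open import Data.List.Relation.Unary.Unique.Propositional using (Unique)
open import Relation.Binary.PropositionalEquality using (_≡_; _≢_; refl)
open import Relation.Nullary using (¬_)
open import Function.Definitions using (Injective)

record Graph (n : ℕ) : Set where
  field
    adj    : Fin n → Fin n → Bool
    sym    : ∀ u v → adj u v ≡ adj v u
    irrefl : ∀ v → adj v v ≡ false
open Graph public

Adj : ∀ {n} → Graph n → Fin n → Fin n → Set
Adj G u v = adj G u v ≡ true

record Colouring {n : ℕ} (G : Graph n) : Set where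
  field
    col    : Fin n → Fin n → ℕ
    colSym : ∀ u v → Adj G u v → col u v ≡ col v u
open Colouring public

Proper : ∀ {n} (G : Graph n) → Colouring G → Set
Proper G c = ∀ u v w → Adj G u v → Adj G u w → v ≢ w → col c u v ≢ col c u w

EdgeSet : ℕ → Set
EdgeSet n = Vec (Vec Bool n) n

InE : ∀ {n} → EdgeSet n → Fin n → Fin n → Set
InE E u v = lookup (lookup E u) v ≡ true

SubData : ℕ → Set
SubData n = Subset n × EdgeSet n

IsSubgraph : ∀ {n} → Graph n → SubData n → Set
IsSubgraph G (V' , E') = ∀ u v → InE E' u v → Adj G u v × u ∈ V' × v ∈ V'

IsoTo : ∀ {m n} → Graph m → SubData n → Set
IsoTo {m} {n} H (V' , E') =
  Σ[ f ∈ (Fin m → Fin n) ]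
    Injective _≡_ _≡_ f
    × (∀ v → v ∈ V' → ∃[ i ] f i ≡ v)
    × (∀ i → f i ∈ V')
    × (∀ i j → lookup (lookup E' (f i)) (f j) ≡ adj H i j)

IsCopy : ∀ {m n} → Graph m → Graph n → SubData n → Set
IsCopy H G S = IsSubgraph G S × IsoTo H S

Rainbow : ∀ {n} (G : Graph n) → Colouring G → SubData n → Set
Rainbow G c (V' , E') =
  ∀ u v w x → InE E' u v → InE E' w x →
    ¬ (u ≡ w × v ≡ x) → ¬ (u ≡ x × v ≡ w) → col c u v ≢ col c w x

NoRainbowCopy : ∀ {m n} → Graph m → (G : Graph n) → Colouring G → Set
NoRainbowCopy H G c = ∀ S → IsCopy H G S → ¬ Rainbow G c S

-- ex(n, H, rainbow-F) ≤ k : every admissible (G, c) has at most k copies of H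
-- (any duplicate-free list of copies has length ≤ k).
ExAtMost : ∀ {m l} → Graph m → Graph l → ℕ → ℕ → Set
ExAtMost H F n k =
  ∀ (G : Graph n) (c : Colouring G) → Proper G c → NoRainbowCopy F G c →
  ∀ (cs : List (SubData n)) → Unique cs → All (IsCopy H G) cs → length cs ≤ k

-- ex(n, H, rainbow-F) ≥ k : some admissible (G, c) has at least k copies of H.
ExAtLeast : ∀ {m l} → Graph m → Graph l → ℕ → ℕ → Set
ExAtLeast H F n k =
  Σ[ G ∈ Graph n ] Σ[ c ∈ Colouring G ] Proper G c × NoRainbowCopy F G c ×
  Σ[ cs ∈ List (SubData n) ] Unique cs × All (IsCopy H G) cs × k ≤ length cs

starAdj : ∀ {p} → Fin (suc p) → Fin (suc p) → Bool
starAdj zero    zero    = false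
starAdj zero    (suc _) = true
starAdj (suc _) zero    = true
starAdj (suc _) (suc _) = false

starSym : ∀ {p} (u v : Fin (suc p)) → starAdj u v ≡ starAdj v u
starSym zero    zero    = refl
starSym zero    (suc _) = refl
starSym (suc _) zero    = refl
starSym (suc _) (suc _) = refl

starIrr : ∀ {p} (v : Fin (suc p)) → starAdj v v ≡ false
starIrr zero    = refl
starIrr (suc _) = refl

forestAdj' : ∀ {p r} → Fin (suc p) ⊎ Fin (suc r) → Fin (suc p) ⊎ Fin (suc r) → Bool
forestAdj' (inj₁ a) (inj₁ b) = starAdj a b
forestAdj' (inj₂ a) (inj₂ b) = starAdj a b
forestAdj' (inj₁ _) (inj₂ _) = false
forestAdj' (inj₂ _) (inj₁ _) = false

forestSym' : ∀ {p r} (x y : Fin (suc p) ⊎ Fin (suc r)) → forestAdj' x y ≡ forestAdj' y x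
forestSym' (inj₁ a) (inj₁ b) = starSym a b
forestSym' (inj₂ a) (inj₂ b) = starSym a b
forestSym' (inj₁ _) (inj₂ _) = refl
forestSym' (inj₂ _) (inj₁ _) = refl

forestIrr' : ∀ {p r} (x : Fin (suc p) ⊎ Fin (suc r)) → forestAdj' x x ≡ false
forestIrr' (inj₁ a) = starIrr a
forestIrr' (inj₂ a) = starIrr a

TwoStars : (p r : ℕ) → Graph (suc p + suc r)
TwoStars p r = record
  { adj    = λ u v → forestAdj' (splitAt (suc p) u) (splitAt (suc p) v)
  ; sym    = λ u v → forestSym' (splitAt (suc p) u) (splitAt (suc p) v)
  ; irrefl = λ v → forestIrr' (splitAt (suc p) v)
  }

-- Upper bound: in a proper colouring without a rainbow S_p ∪ S_r both centres of every copy
-- have bounded degree.  Were the first centre of degree at least p + (r + 1) + r, one could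
-- re-choose its p leaves among its neighbours avoiding the r + 1 vertices of the second star and
-- the r colours on it; properness makes the new colours distinct, so the result is rainbow.
-- Hence a copy is determined by its two centres and the positions of its leaves in the
-- neighbour lists of the centres, giving at most D^(p+r) n² copies.
-- Lower bound: 2h vertex-disjoint stars S_q with q = p + r - 1, the i-th leaf of every star
-- coloured i.  This proper colouring uses fewer than p + r colours, so it has no rainbow copy,
-- and a star of the first h paired with one of the last h gives h² ≈ n² / (4(q+1)²) copies.

module Submission where

open import Defs hiding (sym)

open import Data.Bool using (Bool; true; false; _∧_)
import Data.Bool as Bool
open import Data.Bool.Properties using (⇔→≡; ∧-zeroʳ)
open import Data.Empty using (⊥-elim)
open import Data.Fin
  using (Fin; zero; suc; splitAt; join; toℕ; inject≤; fromℕ<; combine; remQuot; funToFin; finToFun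
        ; _↑ˡ_; _↑ʳ_)
import Data.Fin.Properties as Fin
open import Data.Fin.Properties
  using ( any?; _≟_; injective⇒≤; pigeonhole; toℕ<n; toℕ-injective; toℕ-fromℕ<; toℕ-inject≤
        ; inject≤-injective; ↑ˡ-injective; ↑ʳ-injective; splitAt-↑ˡ; splitAt-↑ʳ; splitAt⁻¹-↑ˡ
        ; splitAt-join; join-splitAt; combine-injective; remQuot-combine; combine-remQuot; finToFun-funToFin )
open import Data.Fin.Subset using (_⊆_) renaming (_∈_ to _∈ₛ_)
open import Data.Fin.Subset.Properties using (⊆-antisym)
open import Data.List using (List; []; _∷_; length; filter; allFin)
import Data.List as List
open import Data.List.Membership.Propositional using (_∈_)
open import Data.List.Membership.Propositional.Properties using (∈-lookup; ∈-filter⁻; ∈-filter⁺; ∈-allFin)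
open import Data.List.Properties using (length-tabulate)
import Data.List.Relation.Unary.All as All
import Data.List.Relation.Unary.All.Properties as Allₚ
open import Data.List.Relation.Unary.Any using (index)
open import Data.List.Relation.Unary.Any.Properties using (lookup-index)
open import Data.List.Relation.Unary.Unique.Propositional using (Unique; _∷_)
open import Data.List.Relation.Unary.Unique.Propositional.Properties using (filter⁺; allFin⁺)
import Data.List.Relation.Unary.Unique.Propositional.Properties as Uniqueₚ
open import Data.Maybe using (Maybe; just; nothing)
open import Data.Nat using (ℕ; zero; suc; _+_; _*_; _^_; _∸_; _≤_; _<_; s≤s; NonZero)
import Data.Nat as ℕ
open import Data.Nat.DivMod using (_/_; _%_; m≡m%n+[m/n]*n; m%n<n; m/n*n≤m; m≥n⇒m/n>0)
open import Data.Nat.Properties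
  using ( ≤-reflexive; ≤-trans; <⇒≤; <-≤-trans; ≰⇒>; m≤m+n; m≤n+m; m+[n∸m]≡n; +-suc; +-comm
        ; +-cancelʳ-≤; +-monoˡ-≤; *-comm; *-identityˡ; *-monoˡ-≤; *-mono-≤; module ≤-Reasoning )
open import Data.Nat.Tactic.RingSolver using (solve-∀)
open import Data.Product using (_×_; _,_; proj₁; proj₂; ∃; ∃₂; ∃-syntax; Σ-syntax; uncurry)
open import Data.Sum using (_⊎_; inj₁; inj₂; [_,_]; [_,_]′)
open import Data.Sum.Properties using (inj₁-injective; inj₂-injective; [,]-cong)
open import Data.Vec using (lookup; tabulate)
import Data.Vec.Functional as Vector
open import Data.Vec.Properties using (lookup∘tabulate; []=⇒lookup; lookup⇒[]=)
open import Data.Vec.Relation.Binary.Pointwise.Extensional using (ext; Pointwise-≡⇒≡)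
open import Function using (_∘_; const; mk⇔)
open import Function.Definitions using (Injective)
open import Relation.Binary.PropositionalEquality
  using (_≡_; _≢_; _≗_; refl; sym; trans; cong; cong₂; subst; subst₂)
open import Relation.Nullary using (¬_; Dec; yes; no; does; _×-dec_; _⊎-dec_)
open import Relation.Nullary.Decidable using (decidable-stable; dec-true; does-⇔)
open import Relation.Unary using (Decidable)
open import Relation.Unary.Properties using (∁?)

data SameEdge {A : Set} : A × A → A × A → Set where
  forward : ∀ {x y} → SameEdge (x , y) (x , y)
  backward : ∀ {x y} → SameEdge (x , y) (y , x)

module _ {A : Set} where

  SameEdge-sym : ∀ {a b : A × A} → SameEdge a b → SameEdge b a
  SameEdge-sym forward = forward
  SameEdge-sym backward = backward

  SameEdge-trans : ∀ {a b c : A × A} → SameEdge a b → SameEdge b c → SameEdge a c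
  SameEdge-trans forward e = e
  SameEdge-trans backward forward = backward
  SameEdge-trans backward backward = forward

  SameEdge⇒≡⊎≡ : ∀ {x y z w : A} → SameEdge (x , y) (z , w) →
    (x ≡ z × y ≡ w) ⊎ (x ≡ w × y ≡ z)
  SameEdge⇒≡⊎≡ forward = inj₁ (refl , refl)
  SameEdge⇒≡⊎≡ backward = inj₂ (refl , refl)

SameEdge-map : ∀ {A B : Set} (f : A → B) {a b : A × A} →
  SameEdge a b → SameEdge (f (proj₁ a) , f (proj₂ a)) (f (proj₁ b) , f (proj₂ b))
SameEdge-map f forward = forward
SameEdge-map f backward = backward

true⇒witness : ∀ {A : Set} (a? : Dec A) → does a? ≡ true → A
true⇒witness (yes a) _ = a
true⇒witness (no _) ()

↑ˡ≢↑ʳ : ∀ {m n} (i : Fin m) (j : Fin n) → i ↑ˡ n ≢ m ↑ʳ j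
↑ˡ≢↑ʳ {m} {n} i j e with trans (sym (splitAt-↑ˡ m i n)) (trans (cong (splitAt m) e) (splitAt-↑ʳ m n j))
... | ()

join-injective : ∀ m n → Injective _≡_ _≡_ (join m n)
join-injective m n {x} {y} e = trans (sym (splitAt-join m n x)) (trans (cong (splitAt m) e) (splitAt-join m n y))

splitAt-injective : ∀ m n → Injective _≡_ _≡_ (splitAt m {n})
splitAt-injective m n {i} {j} e = trans (sym (join-splitAt m n i)) (trans (cong (join m n) e) (join-splitAt m n j))

module _ {A : Set} where

  lookup-injective : ∀ {xs : List A} → Unique xs → ∀ {i j} → List.lookup xs i ≡ List.lookup xs j → i ≡ j
  lookup-injective {_ ∷ _} _ {zero} {zero} _ = refl
  lookup-injective {_ ∷ _} (x∉ ∷ _) {zero} {suc j} e = ⊥-elim (All.lookup x∉ (∈-lookup j) e)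
  lookup-injective {_ ∷ _} (x∉ ∷ _) {suc i} {zero} e = ⊥-elim (All.lookup x∉ (∈-lookup i) (sym e))
  lookup-injective {_ ∷ _} (_ ∷ u) {suc i} {suc j} e = cong suc (lookup-injective u e)

  injectiveOn⇒length≤ : ∀ {xs : List A} {K} → Unique xs →
    (code : ∀ {x} → x ∈ xs → Fin K) →
    (∀ {x y} (x∈ : x ∈ xs) (y∈ : y ∈ xs) → code x∈ ≡ code y∈ → x ≡ y) →
    length xs ≤ K
  injectiveOn⇒length≤ uniq code code-inj =
    injective⇒≤ {f = λ i → code (∈-lookup i)} (λ e → lookup-injective uniq (code-inj _ _ e))

  module _ {Bad : A → Set} (bad? : Decidable Bad) where

    length-filter+length-filter-∁ : ∀ xs → length (filter bad? xs) + length (filter (∁? bad?) xs) ≡ length xs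
    length-filter+length-filter-∁ [] = refl
    length-filter+length-filter-∁ (x ∷ xs) with bad? x
    ... | yes _ = cong suc (length-filter+length-filter-∁ xs)
    ... | no _ = trans (+-suc _ _) (cong suc (length-filter+length-filter-∁ xs))

    pickAvoiding : ∀ {xs : List A} {k m} → Unique xs →
      (code : ∀ {x} → x ∈ xs → Bad x → Fin m) →
      (∀ {x y} (x∈ : x ∈ xs) (y∈ : y ∈ xs) bx by → code x∈ bx ≡ code y∈ by → x ≡ y) →
      k + m ≤ length xs →
      Σ[ f ∈ (Fin k → A) ] Injective _≡_ _≡_ f × (∀ i → f i ∈ xs × ¬ Bad (f i))
    pickAvoiding {xs} {k} {m} uniq code code-inj k+m≤ =
      pick , (λ e → inject≤-injective _ _ _ _ (lookup-injective (filter⁺ (∁? bad?) uniq) e)) ,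
      (λ i → ∈-filter⁻ (∁? bad?) (∈-lookup (inject≤ i k≤good)))
      where
      bads = filter bad? xs
      goods = filter (∁? bad?) xs

      bads≤m : length bads ≤ m
      bads≤m = injectiveOn⇒length≤ (filter⁺ bad? uniq)
        (λ x∈ → uncurry code (∈-filter⁻ bad? x∈))
        (λ x∈ y∈ → code-inj _ _ _ _)

      k≤good : k ≤ length goods
      k≤good = +-cancelʳ-≤ m k (length goods) (begin
        k + m                       ≤⟨ k+m≤ ⟩
        length xs                   ≡⟨ length-filter+length-filter-∁ xs ⟨
        length bads + length goods  ≤⟨ +-monoˡ-≤ (length goods) bads≤m ⟩
        m + length goods            ≡⟨ +-comm m (length goods) ⟩
        length goods + m            ∎)
        where open ≤-Reasoning

      pick : Fin k → A
      pick i = List.lookup goods (inject≤ i k≤good)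

module _ {n} (G : Graph n) where

  Adj⇒≢ : ∀ {u v} → Adj G u v → u ≢ v
  Adj⇒≢ {u} uv refl with trans (sym uv) (irrefl G u)
  ... | ()

  Adj-sym : ∀ {u v} → Adj G u v → Adj G v u
  Adj-sym {u} {v} uv = trans (Graph.sym G v u) uv

  Adj? : ∀ u → Decidable (Adj G u)
  Adj? u v = adj G u v Bool.≟ true

  neighbours : Fin n → List (Fin n)
  neighbours u = filter (Adj? u) (allFin n)

  degree : Fin n → ℕ
  degree u = length (neighbours u)

  neighbours-unique : ∀ u → Unique (neighbours u)
  neighbours-unique u = filter⁺ (Adj? u) (allFin⁺ n)

  ∈-neighbours⁻ : ∀ {u v} → v ∈ neighbours u → Adj G u v
  ∈-neighbours⁻ {u} v∈ = proj₂ (∈-filter⁻ (Adj? u) {xs = allFin n} v∈)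

  ∈-neighbours⁺ : ∀ {u v} → Adj G u v → v ∈ neighbours u
  ∈-neighbours⁺ {u} {v} uv = ∈-filter⁺ (Adj? u) (∈-allFin v) uv

  neighbourIndex : ∀ {u v} → Adj G u v → Fin (degree u)
  neighbourIndex uv = index (∈-neighbours⁺ uv)

  neighbourIndex-injective : ∀ {u u' v v'} → u ≡ u' → (uv : Adj G u v) (uv' : Adj G u' v') →
    toℕ (neighbourIndex uv) ≡ toℕ (neighbourIndex uv') → v ≡ v'
  neighbourIndex-injective {u} refl uv uv' e =
    trans (lookup-index (∈-neighbours⁺ uv))
      (trans (cong (List.lookup (neighbours u)) (toℕ-injective e)) (sym (lookup-index (∈-neighbours⁺ uv'))))

  Proper⇒col-injective : ∀ (c : Colouring G) → Proper G c → ∀ {u v w} →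
    Adj G u v → Adj G u w → col c u v ≡ col c u w → v ≡ w
  Proper⇒col-injective c proper {u} {v} {w} uv uw same =
    decidable-stable (v ≟ w) (λ v≢w → proper u v w uv uw v≢w same)

  col-SameEdge : ∀ (c : Colouring G) {u v u' v'} → Adj G u v →
    SameEdge (u , v) (u' , v') → col c u v ≡ col c u' v'
  col-SameEdge c uv forward = refl
  col-SameEdge c uv backward = colSym c _ _ uv

module Image {m n} (H : Graph m) (f : Fin m → Fin n) where

  IsEdge : Fin n → Fin n → Set
  IsEdge u v = ∃₂ λ i j → f i ≡ u × f j ≡ v × adj H i j ≡ true

  preimage? : ∀ v → Dec (∃ λ i → f i ≡ v)
  preimage? v = any? λ i → f i ≟ v

  isEdge? : ∀ u v → Dec (IsEdge u v)
  isEdge? u v = any? λ i → any? λ j → f i ≟ u ×-dec f j ≟ v ×-dec adj H i j Bool.≟ true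

  image : SubData n
  image = tabulate (λ v → does (preimage? v)) , tabulate (λ u → tabulate (λ v → does (isEdge? u v)))

  ∈-image⁻ : ∀ {v} → v ∈ₛ proj₁ image → ∃ λ i → f i ≡ v
  ∈-image⁻ {v} v∈ = true⇒witness (preimage? v) (trans (sym (lookup∘tabulate _ v)) ([]=⇒lookup v∈))

  ∈-image⁺ : ∀ i → f i ∈ₛ proj₁ image
  ∈-image⁺ i = lookup⇒[]= (f i) _ (trans (lookup∘tabulate _ (f i)) (dec-true (preimage? (f i)) (i , refl)))

  InE-image⁻ : ∀ {u v} → InE (proj₂ image) u v → IsEdge u v
  InE-image⁻ {u} {v} e = true⇒witness (isEdge? u v)
    (trans (sym (trans (cong (λ row → lookup row v) (lookup∘tabulate _ u)) (lookup∘tabulate _ v))) e)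

  module _ (f-injective : Injective _≡_ _≡_ f) where

    image-adj : ∀ i j → lookup (lookup (proj₂ image) (f i)) (f j) ≡ adj H i j
    image-adj i j = trans (cong (λ row → lookup row (f j)) (lookup∘tabulate _ (f i)))
      (trans (lookup∘tabulate _ (f j)) (⇔→≡ {z = true} (mk⇔ to from)))
      where
      to : does (isEdge? (f i) (f j)) ≡ true → adj H i j ≡ true
      to e with true⇒witness (isEdge? (f i) (f j)) e
      ... | i' , j' , fi , fj , a = subst₂ (λ x y → adj H x y ≡ true) (f-injective fi) (f-injective fj) a
      from : adj H i j ≡ true → does (isEdge? (f i) (f j)) ≡ true
      from a = dec-true (isEdge? (f i) (f j)) (i , j , refl , refl , a)

    image-copy : ∀ {G : Graph n} → (∀ {i j} → adj H i j ≡ true → Adj G (f i) (f j)) → IsCopy H G image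
    image-copy {G} hom = subgraph , f , f-injective , (λ v → ∈-image⁻) , ∈-image⁺ , image-adj
      where
      subgraph : IsSubgraph G image
      subgraph u v e with InE-image⁻ e
      ... | i , j , refl , refl , a = hom a , ∈-image⁺ i , ∈-image⁺ j

  image-rainbow : ∀ {G : Graph n} (c : Colouring G) →
    (∀ i j k l → adj H i j ≡ true → adj H k l ≡ true → col c (f i) (f j) ≡ col c (f k) (f l) →
       SameEdge (f i , f j) (f k , f l)) →
    Rainbow G c image
  image-rainbow c sameEdge u v w x uv wx ¬same₁ ¬same₂ eq with InE-image⁻ uv | InE-image⁻ wx
  ... | i , j , refl , refl , a | k , l , refl , refl , b =
    [ ¬same₁ , ¬same₂ ] (SameEdge⇒≡⊎≡ (sameEdge i j k l a b eq))

module Copy {m n} (H : Graph m) (G : Graph n) where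

  module _ {S : SubData n} (cp : IsCopy H G S) where

    embedding : Fin m → Fin n
    embedding = proj₁ (proj₂ cp)

    embedding-injective : Injective _≡_ _≡_ embedding
    embedding-injective = proj₁ (proj₂ (proj₂ cp))

    copy-adj : ∀ i j → lookup (lookup (proj₂ S) (embedding i)) (embedding j) ≡ adj H i j
    copy-adj = proj₂ (proj₂ (proj₂ (proj₂ (proj₂ cp))))

    embedding-InE : ∀ {i j} → adj H i j ≡ true → InE (proj₂ S) (embedding i) (embedding j)
    embedding-InE {i} {j} a = trans (copy-adj i j) a

    embedding-Adj : ∀ {i j} → adj H i j ≡ true → Adj G (embedding i) (embedding j)
    embedding-Adj a = proj₁ (proj₁ cp _ _ (embedding-InE a))

    copy-vertex⁻ : ∀ {v} → v ∈ₛ proj₁ S → ∃ λ i → embedding i ≡ v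
    copy-vertex⁻ = proj₁ (proj₂ (proj₂ (proj₂ cp))) _

    copy-vertex⁺ : ∀ i → embedding i ∈ₛ proj₁ S
    copy-vertex⁺ = proj₁ (proj₂ (proj₂ (proj₂ (proj₂ cp))))

    copy-edge⁻ : ∀ {u v} → InE (proj₂ S) u v →
      ∃₂ λ i j → embedding i ≡ u × embedding j ≡ v × adj H i j ≡ true
    copy-edge⁻ e with proj₁ cp _ _ e
    ... | _ , u∈ , v∈ with copy-vertex⁻ u∈ | copy-vertex⁻ v∈
    ... | i , refl | j , refl = i , j , refl , refl , trans (sym (copy-adj i j)) e


  copy-⊆ : ∀ {S S'} (cp : IsCopy H G S) (cp' : IsCopy H G S') → embedding {S} cp ≗ embedding {S'} cp' →
    proj₁ S ⊆ proj₁ S' × (∀ u → lookup (proj₂ S) u ⊆ lookup (proj₂ S') u)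
  copy-⊆ {S} {S'} cp cp' same = vertices⊆ , edges⊆
    where
    vertices⊆ : proj₁ S ⊆ proj₁ S'
    vertices⊆ v∈ with copy-vertex⁻ {S} cp v∈
    ... | i , refl = subst (_∈ₛ proj₁ S') (sym (same i)) (copy-vertex⁺ {S'} cp' i)
    edges⊆ : ∀ u → lookup (proj₂ S) u ⊆ lookup (proj₂ S') u
    edges⊆ u {v} uv∈ with copy-edge⁻ {S} cp ([]=⇒lookup uv∈)
    ... | i , j , refl , refl , a = lookup⇒[]= v _
      (subst₂ (InE (proj₂ S')) (sym (same i)) (sym (same j)) (embedding-InE {S'} cp' a))

  copy-≗⇒≡ : ∀ {S S'} (cp : IsCopy H G S) (cp' : IsCopy H G S') →
    embedding {S} cp ≗ embedding {S'} cp' → S ≡ S'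
  copy-≗⇒≡ {S} {S'} cp cp' same = cong₂ _,_
    (⊆-antisym (proj₁ ⊆₁) (proj₁ ⊆₂))
    (Pointwise-≡⇒≡ (ext λ u → ⊆-antisym (proj₂ ⊆₁ u) (proj₂ ⊆₂ u)))
    where
    ⊆₁ = copy-⊆ {S} {S'} cp cp' same
    ⊆₂ = copy-⊆ {S'} {S} cp' cp (sym ∘ same)

record Star {n} (G : Graph n) (k : ℕ) : Set where
  field
    vertex : Fin (suc k) → Fin n
    vertex-injective : Injective _≡_ _≡_ vertex
    centre-adj : ∀ i → Adj G (vertex zero) (vertex (suc i))

  centre : Fin n
  centre = vertex zero

  leaf : Fin k → Fin n
  leaf = vertex ∘ suc

  vertex-hom : ∀ x y → starAdj x y ≡ true → Adj G (vertex x) (vertex y)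
  vertex-hom zero (suc i) _ = centre-adj i
  vertex-hom (suc i) zero _ = Adj-sym G (centre-adj i)

  leafColour : Colouring G → Fin k → ℕ
  leafColour c i = col c centre (leaf i)

open Star public

module _ {p r : ℕ} where

  TwoStars-adj-join : ∀ x y →
    adj (TwoStars p r) (join (suc p) (suc r) x) (join (suc p) (suc r) y) ≡ forestAdj' x y
  TwoStars-adj-join x y = cong₂ forestAdj' (splitAt-join (suc p) (suc r) x) (splitAt-join (suc p) (suc r) y)

  ends : Fin p ⊎ Fin r → (Fin (suc p) ⊎ Fin (suc r)) × (Fin (suc p) ⊎ Fin (suc r))
  ends (inj₁ i) = inj₁ zero , inj₁ (suc i)
  ends (inj₂ j) = inj₂ zero , inj₂ (suc j)

  ends-adj : ∀ e → forestAdj' (proj₁ (ends e)) (proj₂ (ends e)) ≡ true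
  ends-adj (inj₁ _) = refl
  ends-adj (inj₂ _) = refl

  ends-leaf-injective : ∀ e e' → proj₂ (ends e) ≡ proj₂ (ends e') → e ≡ e'
  ends-leaf-injective (inj₁ _) (inj₁ _) refl = refl
  ends-leaf-injective (inj₂ _) (inj₂ _) refl = refl

  ends-centre≢leaf : ∀ e e' → proj₁ (ends e) ≢ proj₂ (ends e')
  ends-centre≢leaf (inj₁ _) (inj₁ _) ()
  ends-centre≢leaf (inj₂ _) (inj₂ _) ()

  forestAdj'⇒ends : ∀ x y → forestAdj' {p} {r} x y ≡ true → ∃ λ e → SameEdge (x , y) (ends e)
  forestAdj'⇒ends (inj₁ zero) (inj₁ (suc i)) _ = inj₁ i , forward
  forestAdj'⇒ends (inj₁ (suc i)) (inj₁ zero) _ = inj₁ i , backward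
  forestAdj'⇒ends (inj₂ zero) (inj₂ (suc j)) _ = inj₂ j , forward
  forestAdj'⇒ends (inj₂ (suc j)) (inj₂ zero) _ = inj₂ j , backward

module _ {n} {G : Graph n} {p r} (A : Star G p) (B : Star G r) where

  Disjoint : Set
  Disjoint = ∀ x y → vertex A x ≢ vertex B y

  ColourDisjoint : Colouring G → Set
  ColourDisjoint c = ∀ i j → leafColour A c i ≢ leafColour B c j

  pairVertex : Fin (suc p) ⊎ Fin (suc r) → Fin n
  pairVertex = [ vertex A , vertex B ]′

  twoStarsMap : Fin (suc p + suc r) → Fin n
  twoStarsMap = pairVertex ∘ splitAt (suc p)

  twoStarsImage : SubData n
  twoStarsImage = Image.image (TwoStars p r) twoStarsMap

  pairVertex-hom : ∀ x y → forestAdj' x y ≡ true → Adj G (pairVertex x) (pairVertex y)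
  pairVertex-hom (inj₁ x) (inj₁ y) xy = vertex-hom A x y xy
  pairVertex-hom (inj₂ x) (inj₂ y) xy = vertex-hom B x y xy

  ∈-twoStarsImage⁻ : ∀ {v} → v ∈ₛ proj₁ twoStarsImage → ∃ λ x → pairVertex x ≡ v
  ∈-twoStarsImage⁻ v∈ with Image.∈-image⁻ (TwoStars p r) twoStarsMap v∈
  ... | i , eq = splitAt (suc p) i , eq

  ∈-twoStarsImage⁺ : ∀ x → pairVertex x ∈ₛ proj₁ twoStarsImage
  ∈-twoStarsImage⁺ x = subst (_∈ₛ proj₁ twoStarsImage) (cong pairVertex (splitAt-join (suc p) (suc r) x))
    (Image.∈-image⁺ (TwoStars p r) twoStarsMap (join (suc p) (suc r) x))

  module _ (disjoint : Disjoint) where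

    pairVertex-injective : Injective _≡_ _≡_ pairVertex
    pairVertex-injective {inj₁ x} {inj₁ x'} e = cong inj₁ (vertex-injective A e)
    pairVertex-injective {inj₁ x} {inj₂ y} e = ⊥-elim (disjoint x y e)
    pairVertex-injective {inj₂ y} {inj₁ x} e = ⊥-elim (disjoint x y (sym e))
    pairVertex-injective {inj₂ y} {inj₂ y'} e = cong inj₂ (vertex-injective B e)

    twoStarsCopy : IsCopy (TwoStars p r) G twoStarsImage
    twoStarsCopy = Image.image-copy (TwoStars p r) twoStarsMap
      (λ {i} {j} e → splitAt-injective (suc p) (suc r)
                       (pairVertex-injective {splitAt (suc p) i} {splitAt (suc p) j} e))
      {G} (λ {i} {j} → pairVertex-hom (splitAt (suc p) i) (splitAt (suc p) j))

    module _ (c : Colouring G) (proper : Proper G c) (colourDisjoint : ColourDisjoint c) where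

      edgeColour : Fin p ⊎ Fin r → ℕ
      edgeColour e = col c (pairVertex (proj₁ (ends e))) (pairVertex (proj₂ (ends e)))

      edgeColour-injective : Injective _≡_ _≡_ edgeColour
      edgeColour-injective {inj₁ i} {inj₁ i'} e =
        cong inj₁ (Fin.suc-injective (vertex-injective A
          (Proper⇒col-injective G c proper (centre-adj A i) (centre-adj A i') e)))
      edgeColour-injective {inj₁ i} {inj₂ j} e = ⊥-elim (colourDisjoint i j e)
      edgeColour-injective {inj₂ j} {inj₁ i} e = ⊥-elim (colourDisjoint i j (sym e))
      edgeColour-injective {inj₂ j} {inj₂ j'} e =
        cong inj₂ (Fin.suc-injective (vertex-injective B
          (Proper⇒col-injective G c proper (centre-adj B j) (centre-adj B j') e)))

      edgeColour-SameEdge : ∀ x y e → forestAdj' x y ≡ true → SameEdge (x , y) (ends e) →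
        col c (pairVertex x) (pairVertex y) ≡ edgeColour e
      edgeColour-SameEdge x y e xy same = col-SameEdge G c (pairVertex-hom x y xy) (SameEdge-map pairVertex same)

      pairVertex-sameColour : ∀ x y z w → forestAdj' x y ≡ true → forestAdj' z w ≡ true →
        col c (pairVertex x) (pairVertex y) ≡ col c (pairVertex z) (pairVertex w) → SameEdge (x , y) (z , w)
      pairVertex-sameColour x y z w xy zw same with forestAdj'⇒ends x y xy | forestAdj'⇒ends z w zw
      ... | e , xy~e | e' , zw~e'
        with edgeColour-injective {e} {e'} (trans (sym (edgeColour-SameEdge x y e xy xy~e))
                                                 (trans same (edgeColour-SameEdge z w e' zw zw~e')))
      ... | refl = SameEdge-trans xy~e (SameEdge-sym zw~e')

      twoStarsCopy-rainbow : Rainbow G c twoStarsImage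
      twoStarsCopy-rainbow = Image.image-rainbow (TwoStars p r) twoStarsMap c λ i j k l ij kl same →
        SameEdge-map pairVertex (pairVertex-sameColour (splitAt (suc p) i) (splitAt (suc p) j)
                                                        (splitAt (suc p) k) (splitAt (suc p) l) ij kl same)

module CopyStars {n p r} {G : Graph n} {S : SubData n} (cp : IsCopy (TwoStars p r) G S) where
  open Copy (TwoStars p r) G

  pairEmbedding : Fin (suc p) ⊎ Fin (suc r) → Fin n
  pairEmbedding = embedding {S} cp ∘ join (suc p) (suc r)

  pairEmbedding-injective : Injective _≡_ _≡_ pairEmbedding
  pairEmbedding-injective e = join-injective (suc p) (suc r) (embedding-injective {S} cp e)

  pairEmbedding-InE : ∀ x y → forestAdj' x y ≡ true → InE (proj₂ S) (pairEmbedding x) (pairEmbedding y)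
  pairEmbedding-InE x y xy = embedding-InE {S} cp (trans (TwoStars-adj-join x y) xy)

  pairEmbedding-Adj : ∀ x y → forestAdj' x y ≡ true → Adj G (pairEmbedding x) (pairEmbedding y)
  pairEmbedding-Adj x y xy = embedding-Adj {S} cp (trans (TwoStars-adj-join x y) xy)

  first : Star G p
  first = record
    { vertex = pairEmbedding ∘ inj₁
    ; vertex-injective = λ e → inj₁-injective (pairEmbedding-injective e)
    ; centre-adj = λ i → pairEmbedding-Adj (inj₁ zero) (inj₁ (suc i)) refl
    }

  second : Star G r
  second = record
    { vertex = pairEmbedding ∘ inj₂
    ; vertex-injective = λ e → inj₂-injective (pairEmbedding-injective e)
    ; centre-adj = λ j → pairEmbedding-Adj (inj₂ zero) (inj₂ (suc j)) refl
    }

  disjoint : Disjoint first second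
  disjoint x y e with pairEmbedding-injective {inj₁ x} {inj₂ y} e
  ... | ()

  embedding≗twoStarsMap : embedding {S} cp ≗ twoStarsMap first second
  embedding≗twoStarsMap i = trans (cong (embedding {S} cp) (sym (join-splitAt (suc p) (suc r) i)))
    (pairEmbedding≗pairVertex (splitAt (suc p) i))
    where
    pairEmbedding≗pairVertex : pairEmbedding ≗ pairVertex first second
    pairEmbedding≗pairVertex (inj₁ _) = refl
    pairEmbedding≗pairVertex (inj₂ _) = refl

fewColours⇒noRainbow : ∀ {n p r q} {G : Graph n} (c : Colouring G) → q < p + r →
  (∀ u v → Adj G u v → col c u v < q) → NoRainbowCopy (TwoStars p r) G c
fewColours⇒noRainbow {n} {p} {r} {G = G} c q<p+r small S cp = notRainbow
  where
  open CopyStars {p = p} {r = r} {G = G} {S = S} cp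
  centreOf leafOf : Fin (p + r) → Fin (suc p) ⊎ Fin (suc r)
  centreOf k = proj₁ (ends (splitAt p k))
  leafOf k = proj₂ (ends (splitAt p k))
  edge-InE : ∀ k → InE (proj₂ S) (pairEmbedding (centreOf k)) (pairEmbedding (leafOf k))
  edge-InE k = pairEmbedding-InE (centreOf k) (leafOf k) (ends-adj (splitAt p k))
  colour : Fin (p + r) → Fin _
  colour k = fromℕ< (small _ _ (pairEmbedding-Adj (centreOf k) (leafOf k) (ends-adj (splitAt p k))))
  notRainbow : ¬ Rainbow G c S
  notRainbow rainbow with pigeonhole q<p+r colour
  ... | k , l , k<l , sameColour =
    rainbow _ _ _ _ (edge-InE k) (edge-InE l)
      (λ (_ , e) → Fin.<⇒≢ k<l (splitAt-injective p r (ends-leaf-injective (splitAt p k) (splitAt p l)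
        (pairEmbedding-injective {leafOf k} {leafOf l} e))))
      (λ (e , _) → ends-centre≢leaf (splitAt p k) (splitAt p l)
        (pairEmbedding-injective {centreOf k} {leafOf l} e))
      (trans (sym (toℕ-fromℕ< _)) (trans (cong toℕ sameColour) (toℕ-fromℕ< _)))

module _ {n} {G : Graph n} (c : Colouring G) (proper : Proper G c) where

  -- Each vertex of B and each colour on B rules out at most one neighbour of a (colours by
  -- properness), so k neighbours survive.
  extendAvoiding : ∀ {k k'} (B : Star G k') (a : Fin n) → (∀ y → a ≢ vertex B y) →
    k + (suc k' + k') ≤ degree G a → Σ[ A ∈ Star G k ] Disjoint A B × ColourDisjoint A B c
  extendAvoiding {k} {k'} B a a∉B big = A , disjoint , colourDisjoint
    where
    Bad : Fin n → Set
    Bad v = (∃ λ y → v ≡ vertex B y) ⊎ (∃ λ j → col c a v ≡ leafColour B c j)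

    bad? : Decidable Bad
    bad? v = any? (λ y → v ≟ vertex B y) ⊎-dec any? (λ j → col c a v ℕ.≟ leafColour B c j)

    code : ∀ {v} → v ∈ neighbours G a → Bad v → Fin (suc k' + k')
    code _ (inj₁ (y , _)) = y ↑ˡ k'
    code _ (inj₂ (j , _)) = suc k' ↑ʳ j

    code-injective : ∀ {v w} (v∈ : v ∈ neighbours G a) (w∈ : w ∈ neighbours G a) bv bw →
      code v∈ bv ≡ code w∈ bw → v ≡ w
    code-injective _ _ (inj₁ (y , refl)) (inj₁ (y' , refl)) e = cong (vertex B) (↑ˡ-injective k' y y' e)
    code-injective _ _ (inj₁ (y , _)) (inj₂ (j , _)) e = ⊥-elim (↑ˡ≢↑ʳ y j e)
    code-injective _ _ (inj₂ (j , _)) (inj₁ (y , _)) e = ⊥-elim (↑ˡ≢↑ʳ y j (sym e))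
    code-injective v∈ w∈ (inj₂ (j , vj)) (inj₂ (j' , wj')) e with ↑ʳ-injective (suc k') j j' e
    ... | refl = Proper⇒col-injective G c proper (∈-neighbours⁻ G v∈) (∈-neighbours⁻ G w∈)
                   (trans vj (sym wj'))

    picked = pickAvoiding bad? (neighbours-unique G a) code code-injective big
    leaves = proj₁ picked

    leaves-good : ∀ i → leaves i ∈ neighbours G a × ¬ Bad (leaves i)
    leaves-good = proj₂ (proj₂ picked)

    centre-adj′ : ∀ i → Adj G a (leaves i)
    centre-adj′ i = ∈-neighbours⁻ G (proj₁ (leaves-good i))

    vertex-injective′ : Injective _≡_ _≡_ (a Vector.∷ leaves)
    vertex-injective′ {zero} {zero} _ = refl
    vertex-injective′ {zero} {suc i} e = ⊥-elim (Adj⇒≢ G (centre-adj′ i) e)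
    vertex-injective′ {suc i} {zero} e = ⊥-elim (Adj⇒≢ G (centre-adj′ i) (sym e))
    vertex-injective′ {suc i} {suc j} e = cong suc (proj₁ (proj₂ picked) e)

    A : Star G k
    A = record { vertex = a Vector.∷ leaves ; vertex-injective = vertex-injective′ ; centre-adj = centre-adj′ }

    disjoint : Disjoint A B
    disjoint zero y = a∉B y
    disjoint (suc i) y e = proj₂ (leaves-good i) (inj₁ (y , e))

    colourDisjoint : ColourDisjoint A B c
    colourDisjoint i j e = proj₂ (leaves-good i) (inj₂ (j , e))

  module _ {p r} (noRainbow : NoRainbowCopy (TwoStars p r) G c) where

    ¬rainbowPair : (A : Star G p) (B : Star G r) (disjoint : Disjoint A B) → ¬ ColourDisjoint A B c
    ¬rainbowPair A B disjoint colourDisjoint =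
      noRainbow (twoStarsImage A B) (twoStarsCopy A B disjoint)
        (twoStarsCopy-rainbow A B disjoint c proper colourDisjoint)

    module _ (A : Star G p) (B : Star G r) (disjoint : Disjoint A B) where

      degree-centre₁< : degree G (centre A) < p + (suc r + r)
      degree-centre₁< = ≰⇒> λ big →
        let A' , disjoint' , colourDisjoint' = extendAvoiding B (centre A) (disjoint zero) big
        in ¬rainbowPair A' B disjoint' colourDisjoint'

      degree-centre₂< : degree G (centre B) < r + (suc p + p)
      degree-centre₂< = ≰⇒> λ big →
        let B' , disjoint' , colourDisjoint' = extendAvoiding A (centre B) (λ x e → disjoint x zero (sym e)) big
        in ¬rainbowPair A B' (λ x y e → disjoint' y x (sym e)) (λ i j e → colourDisjoint' j i (sym e))

module _ {n} {G : Graph n} where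

  leafCode : ∀ {k D} (A : Star G k) → degree G (centre A) < D → Fin k → Fin D
  leafCode A small i = inject≤ (neighbourIndex G (centre-adj A i)) (<⇒≤ small)

  leafCode-determines : ∀ {k D} (A A' : Star G k)
    (small : degree G (centre A) < D) (small' : degree G (centre A') < D) →
    centre A ≡ centre A' → leafCode A small ≗ leafCode A' small' → vertex A ≗ vertex A'
  leafCode-determines A A' _ _ sameCentre _ zero = sameCentre
  leafCode-determines A A' small small' sameCentre sameCodes (suc i) =
    neighbourIndex-injective G sameCentre (centre-adj A i) (centre-adj A' i)
      (trans (sym (toℕ-inject≤ _ (<⇒≤ small)))
        (trans (cong toℕ (sameCodes i)) (toℕ-inject≤ _ (<⇒≤ small'))))

funToFin-injective : ∀ {k D} {f g : Fin k → Fin D} → funToFin f ≡ funToFin g → f ≗ g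
funToFin-injective {f = f} {g} e i =
  trans (sym (finToFun-funToFin f i)) (trans (cong (λ x → finToFun x i) e) (finToFun-funToFin g i))

degreeBound : ℕ → ℕ → ℕ
degreeBound p r = (p + (suc r + r)) + (r + (suc p + p))

module _ {n p r} {G : Graph n} (c : Colouring G) (proper : Proper G c)
         (noRainbow : NoRainbowCopy (TwoStars p r) G c) where

  module CopyCode {S : SubData n} (cp : IsCopy (TwoStars p r) G S) where
    open CopyStars {p = p} {r = r} {G = G} {S = S} cp public

    degree₁<D : degree G (centre first) < degreeBound p r
    degree₁<D = <-≤-trans (degree-centre₁< c proper noRainbow first second disjoint)
      (m≤m+n (p + (suc r + r)) (r + (suc p + p)))

    degree₂<D : degree G (centre second) < degreeBound p r
    degree₂<D = <-≤-trans (degree-centre₂< c proper noRainbow first second disjoint)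
      (m≤n+m (r + (suc p + p)) (p + (suc r + r)))

    centreCode : Fin (n * n)
    centreCode = combine (centre first) (centre second)

    leafCodes : Fin (degreeBound p r ^ p * degreeBound p r ^ r)
    leafCodes = combine (funToFin (leafCode first degree₁<D)) (funToFin (leafCode second degree₂<D))

    code : Fin ((n * n) * (degreeBound p r ^ p * degreeBound p r ^ r))
    code = combine centreCode leafCodes

  code-injective : ∀ {S S'} (cp : IsCopy (TwoStars p r) G S) (cp' : IsCopy (TwoStars p r) G S') →
    CopyCode.code {S} cp ≡ CopyCode.code {S'} cp' → S ≡ S'
  code-injective {S} {S'} cp cp' sameCode = Copy.copy-≗⇒≡ (TwoStars p r) G {S} {S'} cp cp' sameEmbedding
    where
    module C = CopyCode {S} cp
    module C' = CopyCode {S'} cp'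
    sameParts = combine-injective C.centreCode C.leafCodes C'.centreCode C'.leafCodes sameCode
    sameCentres = combine-injective (centre C.first) _ (centre C'.first) _ (proj₁ sameParts)
    sameLeafCodes = combine-injective (funToFin (leafCode C.first C.degree₁<D)) _
                                      (funToFin (leafCode C'.first C'.degree₁<D)) _ (proj₂ sameParts)

    sameFirst : vertex C.first ≗ vertex C'.first
    sameFirst = leafCode-determines C.first C'.first C.degree₁<D C'.degree₁<D (proj₁ sameCentres)
      (funToFin-injective (proj₁ sameLeafCodes))

    sameSecond : vertex C.second ≗ vertex C'.second
    sameSecond = leafCode-determines C.second C'.second C.degree₂<D C'.degree₂<D (proj₂ sameCentres)
      (funToFin-injective (proj₂ sameLeafCodes))

    sameEmbedding : Copy.embedding (TwoStars p r) G {S} cp ≗ Copy.embedding (TwoStars p r) G {S'} cp'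
    sameEmbedding i = trans (C.embedding≗twoStarsMap i)
      (trans ([,]-cong sameFirst sameSecond (splitAt (suc p) i)) (sym (C'.embedding≗twoStarsMap i)))

upperBound : ∀ n p r →
  ExAtMost (TwoStars p r) (TwoStars p r) n ((degreeBound p r ^ p * degreeBound p r ^ r) * (n * n))
upperBound n p r G c proper noRainbow copies unique areCopies =
  ≤-trans (injectiveOn⇒length≤ unique
             (λ {S} S∈ → CopyCode.code c proper noRainbow {S} (All.lookup areCopies S∈))
             (λ {S} {S'} S∈ S'∈ → code-injective c proper noRainbow {S} {S'}
                                    (All.lookup areCopies S∈) (All.lookup areCopies S'∈)))
          (≤-reflexive (*-comm (n * n) _))

-- T vertex-disjoint stars S_q followed by e isolated vertices: vtx i a is vertex a of the i-th
-- star (a = zero its centre), and the edge to leaf s has colour s.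
module StarForest (T q e : ℕ) where

  Role : Set
  Role = Maybe (Fin T × Fin (suc q))

  vtx : Fin T → Fin (suc q) → Fin (T * suc q + e)
  vtx i a = combine i a ↑ˡ e

  vtx-injective : ∀ {i j a b} → vtx i a ≡ vtx j b → i ≡ j × a ≡ b
  vtx-injective {i} {j} {a} {b} eq = combine-injective i a j b (↑ˡ-injective e _ _ eq)

  classify : Fin (T * suc q) ⊎ Fin e → Role
  classify = [ just ∘ remQuot (suc q) , const nothing ]′

  role : Fin (T * suc q + e) → Role
  role = classify ∘ splitAt (T * suc q)

  role-vtx : ∀ i a → role (vtx i a) ≡ just (i , a)
  role-vtx i a = trans (cong classify (splitAt-↑ˡ (T * suc q) (combine i a) e)) (cong just (remQuot-combine i a))

  role⇒≡vtx : ∀ {v i a} → role v ≡ just (i , a) → v ≡ vtx i a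
  role⇒≡vtx {v} = go (splitAt (T * suc q) v) refl
    where
    go : ∀ {i a} s → splitAt (T * suc q) v ≡ s → classify s ≡ just (i , a) → v ≡ vtx i a
    go (inj₁ x) split refl =
      trans (sym (splitAt⁻¹-↑ˡ split)) (cong (_↑ˡ e) (sym (combine-remQuot {T} (suc q) x)))

  starColour : Fin (suc q) → Fin (suc q) → ℕ
  starColour zero (suc s) = toℕ s
  starColour (suc s) zero = toℕ s
  starColour _ _ = 0

  starColour-sym : ∀ a b → starColour a b ≡ starColour b a
  starColour-sym zero zero = refl
  starColour-sym zero (suc _) = refl
  starColour-sym (suc _) zero = refl
  starColour-sym (suc _) (suc _) = refl

  starColour-injective : ∀ {a b d} → starAdj a b ≡ true → starAdj a d ≡ true →
    starColour a b ≡ starColour a d → b ≡ d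
  starColour-injective {zero} {suc _} {suc _} _ _ e = cong suc (toℕ-injective e)
  starColour-injective {suc _} {zero} {zero} _ _ _ = refl

  starColour< : ∀ {a b} → starAdj a b ≡ true → starColour a b < q
  starColour< {zero} {suc s} _ = toℕ<n s
  starColour< {suc s} {zero} _ = toℕ<n s

  roleAdj : Role → Role → Bool
  roleAdj (just (i , a)) (just (j , b)) = does (i ≟ j) ∧ starAdj a b
  roleAdj _ _ = false

  roleAdj⇒sameBlock : ∀ x y → roleAdj x y ≡ true →
    ∃₂ λ i a → ∃ λ b → x ≡ just (i , a) × y ≡ just (i , b) × starAdj a b ≡ true
  roleAdj⇒sameBlock (just (i , a)) (just (j , b)) xy with i ≟ j
  ... | yes refl = i , a , b , refl , refl , xy

  roleColour : Role → Role → ℕ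
  roleColour (just (_ , a)) (just (_ , b)) = starColour a b
  roleColour _ _ = 0

  forest : Graph (T * suc q + e)
  forest = record
    { adj = λ u v → roleAdj (role u) (role v)
    ; sym = λ u v → sym′ (role u) (role v)
    ; irrefl = λ v → irrefl′ (role v)
    }
    where
    sym′ : ∀ x y → roleAdj x y ≡ roleAdj y x
    sym′ (just (i , a)) (just (j , b)) = cong₂ _∧_ (does-⇔ (mk⇔ sym sym) (i ≟ j) (j ≟ i)) (starSym a b)
    sym′ (just _) nothing = refl
    sym′ nothing (just _) = refl
    sym′ nothing nothing = refl
    irrefl′ : ∀ x → roleAdj x x ≡ false
    irrefl′ (just (i , a)) = trans (cong (does (i ≟ i) ∧_) (starIrr a)) (∧-zeroʳ _)
    irrefl′ nothing = refl

  colouring : Colouring forest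
  colouring = record
    { col = λ u v → roleColour (role u) (role v)
    ; colSym = λ u v _ → colSym′ (role u) (role v)
    }
    where
    colSym′ : ∀ x y → roleColour x y ≡ roleColour y x
    colSym′ (just (_ , a)) (just (_ , b)) = starColour-sym a b
    colSym′ (just _) nothing = refl
    colSym′ nothing (just _) = refl
    colSym′ nothing nothing = refl

  proper : Proper forest colouring
  proper u v w uv uw v≢w sameColour
    with roleAdj⇒sameBlock (role u) (role v) uv | roleAdj⇒sameBlock (role u) (role w) uw
  ... | i , a , b , ru , rv , ab | i' , a' , d , ru' , rw , ad with trans (sym ru) ru'
  ... | refl = v≢w (trans (role⇒≡vtx rv) (trans (cong (vtx i) b≡d) (sym (role⇒≡vtx rw))))
    where
    b≡d : b ≡ d
    b≡d = starColour-injective ab ad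
      (trans (cong₂ roleColour (sym ru) (sym rv)) (trans sameColour (cong₂ roleColour ru rw)))

  colour< : ∀ u v → Adj forest u v → col colouring u v < q
  colour< u v uv with roleAdj⇒sameBlock (role u) (role v) uv
  ... | i , a , b , ru , rv , ab = subst (_< q) (cong₂ roleColour (sym ru) (sym rv)) (starColour< ab)

  adj-vtx : ∀ i a j b → adj forest (vtx i a) (vtx j b) ≡ does (i ≟ j) ∧ starAdj a b
  adj-vtx i a j b = cong₂ roleAdj (role-vtx i a) (role-vtx j b)

  blockStar : ∀ {k} → k ≤ q → Fin T → Star forest k
  blockStar k≤q i = record
    { vertex = λ x → vtx i (inject≤ x (s≤s k≤q))
    ; vertex-injective = λ eq → inject≤-injective _ _ _ _ (proj₂ (vtx-injective eq))
    ; centre-adj = λ l → trans (adj-vtx i zero i _) (cong (_∧ true) (dec-true (i ≟ i) refl))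
    }

  blockStars-disjoint : ∀ {k k'} (k≤q : k ≤ q) (k'≤q : k' ≤ q) {i j} → i ≢ j →
    Disjoint (blockStar k≤q i) (blockStar k'≤q j)
  blockStars-disjoint _ _ i≢j x y eq = i≢j (proj₁ (vtx-injective eq))

-- Taking the two stars from different halves makes the pair (I , J) readable off the copy.
module BlockPairs (h q e : ℕ) {p r} (p≤q : p ≤ q) (r≤q : r ≤ q) where
  open StarForest (h + h) q e

  leftStar : Fin h → Star forest p
  leftStar I = blockStar p≤q (I ↑ˡ h)

  rightStar : Fin h → Star forest r
  rightStar J = blockStar r≤q (h ↑ʳ J)

  copyAt : Fin h × Fin h → SubData ((h + h) * suc q + e)
  copyAt (I , J) = twoStarsImage (leftStar I) (rightStar J)

  copyAt-isCopy : ∀ IJ → IsCopy (TwoStars p r) forest (copyAt IJ)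
  copyAt-isCopy (I , J) = twoStarsCopy (leftStar I) (rightStar J) (blockStars-disjoint p≤q r≤q (↑ˡ≢↑ʳ I J))

  ∈-copyAt⁻ : ∀ {I J v} → v ∈ₛ proj₁ (copyAt (I , J)) →
    (∃ λ a → v ≡ vtx (I ↑ˡ h) a) ⊎ (∃ λ a → v ≡ vtx (h ↑ʳ J) a)
  ∈-copyAt⁻ {I} {J} v∈ with ∈-twoStarsImage⁻ (leftStar I) (rightStar J) v∈
  ... | inj₁ _ , refl = inj₁ (_ , refl)
  ... | inj₂ _ , refl = inj₂ (_ , refl)

  copyAt-injective : Injective _≡_ _≡_ copyAt
  copyAt-injective {I , J} {I' , J'} eq = cong₂ _,_ sameI sameJ
    where
    member : ∀ x → pairVertex (leftStar I) (rightStar J) x ∈ₛ proj₁ (copyAt (I' , J'))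
    member x = subst (λ S → _ ∈ₛ proj₁ S) eq (∈-twoStarsImage⁺ (leftStar I) (rightStar J) x)
    sameI : I ≡ I'
    sameI with ∈-copyAt⁻ (member (inj₁ zero))
    ... | inj₁ (_ , e) = ↑ˡ-injective h I I' (proj₁ (vtx-injective e))
    ... | inj₂ (_ , e) = ⊥-elim (↑ˡ≢↑ʳ I J' (proj₁ (vtx-injective e)))
    sameJ : J ≡ J'
    sameJ with ∈-copyAt⁻ (member (inj₂ zero))
    ... | inj₁ (_ , e) = ⊥-elim (↑ˡ≢↑ʳ I' J (sym (proj₁ (vtx-injective e))))
    ... | inj₂ (_ , e) = ↑ʳ-injective h J J' (proj₁ (vtx-injective e))

lowerBound : ∀ {p r q} → p ≤ q → r ≤ q → q < p + r →
  ∀ h e → ExAtLeast (TwoStars p r) (TwoStars p r) ((h + h) * suc q + e) (h * h)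
lowerBound {p} {r} {q} p≤q r≤q q<p+r h e =
  forest , colouring , proper , fewColours⇒noRainbow colouring q<p+r colour< ,
  List.tabulate copy , Uniqueₚ.tabulate⁺ copy-injective , Allₚ.tabulate⁺ (copyAt-isCopy ∘ remQuot h) ,
  ≤-reflexive (sym (length-tabulate copy))
  where
  open StarForest (h + h) q e
  open BlockPairs h q e p≤q r≤q
  copy : Fin (h * h) → SubData ((h + h) * suc q + e)
  copy = copyAt ∘ remQuot h
  copy-injective : Injective _≡_ _≡_ copy
  copy-injective {k} {l} eq = trans (sym (combine-remQuot {h} h k))
    (trans (cong (uncurry combine) (copyAt-injective eq)) (combine-remQuot {h} h l))

n≤[w+w]*[n/w] : ∀ n w .{{_ : NonZero w}} → w ≤ n → n ≤ (w + w) * (n / w)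
n≤[w+w]*[n/w] n w w≤n = begin
  n                         ≡⟨ m≡m%n+[m/n]*n n w ⟩
  n % w + n / w * w         ≤⟨ +-monoˡ-≤ (n / w * w) (<⇒≤ (m%n<n n w)) ⟩
  w + n / w * w             ≤⟨ +-monoˡ-≤ (n / w * w) w≤[n/w]*w ⟩
  n / w * w + n / w * w     ≡⟨ rearrange (n / w) w ⟩
  (w + w) * (n / w)         ∎
  where
  open ≤-Reasoning
  w≤[n/w]*w : w ≤ n / w * w
  w≤[n/w]*w = ≤-trans (≤-reflexive (sym (*-identityˡ w))) (*-monoˡ-≤ w (m≥n⇒m/n>0 w≤n))
  rearrange : ∀ a w → a * w + a * w ≡ (w + w) * a
  rearrange = solve-∀

quadraticLowerBound : ∀ {p r q} → p ≤ q → r ≤ q → q < p + r → let w = suc q + suc q in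
  ∀ n → w ≤ n → ∃[ k ] (ExAtLeast (TwoStars p r) (TwoStars p r) n k × n * n ≤ (w + w) * (w + w) * k)
quadraticLowerBound {p} {r} {q} p≤q r≤q q<p+r n w≤n =
  h * h ,
  subst (λ m → ExAtLeast (TwoStars p r) (TwoStars p r) m (h * h)) (m+[n∸m]≡n fits)
    (lowerBound p≤q r≤q q<p+r h (n ∸ (h + h) * suc q)) ,
  ≤-trans (*-mono-≤ (n≤[w+w]*[n/w] n w w≤n) (n≤[w+w]*[n/w] n w w≤n))
          (≤-reflexive (square-of-product (w + w) h))
  where
  w = suc q + suc q
  h = n / w
  double-blocks : ∀ a b → (a + a) * b ≡ a * (b + b)
  double-blocks = solve-∀
  fits : (h + h) * suc q ≤ n
  fits = ≤-trans (≤-reflexive (double-blocks h (suc q))) (m/n*n≤m n w)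
  square-of-product : ∀ a b → (a * b) * (a * b) ≡ (a * a) * (b * b)
  square-of-product = solve-∀

proposition4p3 : ∀ (p r : ℕ) → 1 ≤ p → 1 ≤ r →
    (∃[ C ] ∃[ N ] ∀ n → N ≤ n → ExAtMost (TwoStars p r) (TwoStars p r) n (C * (n * n)))
    × (∃[ c ] ∃[ N ] ∀ n → N ≤ n → ∃[ k ] (ExAtLeast (TwoStars p r) (TwoStars p r) n k × n * n ≤ c * k))
proposition4p3 p@(suc p') r@(suc r') _ _ =
  (degreeBound p r ^ p * degreeBound p r ^ r , 0 , λ n _ → upperBound n p r) ,
  ((w + w) * (w + w) , w , quadraticLowerBound p≤q r≤q q<p+r)
  where
  q = suc (p' + r')
  w = suc q + suc q
  p≤q : p ≤ q
  p≤q = s≤s (m≤m+n p' r')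
  r≤q : r ≤ q
  r≤q = s≤s (m≤n+m r' p')
  q<p+r : q < p + r
  q<p+r = s≤s (≤-reflexive (sym (+-suc p' r')))
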